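{- If a graft $(G,T)$ has a cyclic decomposition, then every minor of $(G,T)$ also has a cyclic decomposition.
   Context: Graphs are finite and may have loops and parallel edges. A graft is a pair $(G,T)$ of a graph $G$ and $T\subseteq V(G)$. A cyclic decomposition of $(G,T)$ is a pair $(H,\mathcal{B})$ where $H$ is a bipartite graph (parallel edges allowed) of maximum degree at most $2$ and $\mathcal{B}=\{B_x:x\in V(H)\}$ is a collection of subsets of $V(G)$ such that: (C1) $\bigcup_{x\in V(H)}B_x=V(G)$; (C2) if $u,v$ are adjacent in $G$ then $\{u,v\}\subseteq B_x$ for some $x\in V(H)$; (C3) for distinct $x,y\in V(H)$, $B_x\cap B_y\subseteq T$ and $|B_x\cap B_y|$ equals the number of edges joining $x$ and $y$ in $H$; (C4) $|T\cap B_x|\le 2$ for all $x\in V(H)$. Graft operations: deleting an edge $e$ gives $(G\setminus e,T)$; deleting an isolated vertex $v$ gives $(G\setminus v,T-\{v\})$; contracting an edge $e=uv$ gives $(G/e,T')$ where, with $e^*$ the vertex of $G/e$ formed from the ends of $e$, $T'=(T-\{u,v\})\cup\{e^*\}$ if $|T\cap\{u,v\}|=1$ and $T'=T-\{u,v\}$ otherwise (if $e$ is a loop, contraction equals deletion). A minor of a graft is one obtained by a sequence of these operations. -}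

module Defs where

open import Data.Nat using (ℕ; zero; suc; _+_; _≤_)
open import Data.Bool using (Bool; true; false; _xor_)
open import Data.Fin using (Fin; zero; suc; _≟_; punchIn; punchOut)
open import Data.Fin.Subset using (Subset; _∈_; _∩_; _⊆_; ∣_∣)
open import Data.Vec using (Vec; tabulate; lookup; removeAt)
open import Data.Product using (Σ; ∃; _×_; _,_; proj₁; proj₂)
open import Data.Sum using (_⊎_)
open import Function using (_∘_)
open import Relation.Nullary using (¬_; Dec; yes; no)
open import Relation.Nullary.Decidable using (_×-dec_; _⊎-dec_)
open import Relation.Binary.PropositionalEquality using (_≡_; _≢_; refl; sym)
open import Relation.Binary.Construct.Closure.ReflexiveTransitive using (Star)

sumFin : ∀ {m} → (Fin m → ℕ) → ℕ
sumFin {zero}  f = 0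
sumFin {suc m} f = f zero + sumFin (f ∘ suc)

ind : ∀ {P : Set} → Dec P → ℕ
ind (yes _) = 1
ind (no _)  = 0

-- A graft: a finite multigraph (loops and parallel edges allowed) on
-- vertex set Fin n with edge set Fin m, each edge having two ends,
-- together with a subset T of the vertices.
record Graft : Set where
  constructor graft
  field
    n    : ℕ
    m    : ℕ
    ends : Fin m → Fin n × Fin n
    T    : Subset n

-- A multigraph H (no terminal set) given by its edge-ends map.
-- degree of x: number of edge-ends at x (a loop counts twice)
degree : ∀ {k p} → (Fin p → Fin k × Fin k) → Fin k → ℕ
degree hends x = sumFin (λ e → ind (proj₁ (hends e) ≟ x) + ind (proj₂ (hends e) ≟ x))

edgesBetween : ∀ {k p} → (Fin p → Fin k × Fin k) → Fin k → Fin k → ℕ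
edgesBetween hends x y =
  sumFin (λ e → ind (((proj₁ (hends e) ≟ x) ×-dec (proj₂ (hends e) ≟ y))
                     ⊎-dec ((proj₁ (hends e) ≟ y) ×-dec (proj₂ (hends e) ≟ x))))

Bipartite : ∀ {k p} → (Fin p → Fin k × Fin k) → Set
Bipartite {k} hends =
  Σ (Fin k → Bool) λ c → ∀ e → c (proj₁ (hends e)) ≢ c (proj₂ (hends e))

record CyclicDecomposition (G : Graft) : Set where
  open Graft G
  field
    k      : ℕ
    p      : ℕ
    hends  : Fin p → Fin k × Fin k
    bip    : Bipartite hends
    maxdeg : ∀ x → degree hends x ≤ 2
    B      : Fin k → Subset n
    C1     : ∀ v → ∃ λ x → v ∈ B x
    C2     : ∀ e → ∃ λ x → proj₁ (ends e) ∈ B x × proj₂ (ends e) ∈ B x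
    C3     : ∀ x y → x ≢ y →
               (B x ∩ B y ⊆ T) × (∣ B x ∩ B y ∣ ≡ edgesBetween hends x y)
    C4     : ∀ x → ∣ T ∩ B x ∣ ≤ 2

-- identify vertices u and v (u ≢ v) of Fin (suc n); v is removed and the
-- merged vertex e* is the image of u
merge : ∀ {n} (u v : Fin (suc n)) → u ≢ v → Fin (suc n) → Fin n
merge u v u≢v w with w ≟ v
... | yes _   = punchOut {i = v} {j = u} (λ eq → u≢v (sym eq))
... | no w≢v  = punchOut {i = v} {j = w} (λ eq → w≢v (sym eq))

mapPair : ∀ {A B : Set} → (A → B) → A × A → B × B
mapPair f (a , b) = f a , f b

contractT : ∀ {n} (u v : Fin (suc n)) → u ≢ v → Subset (suc n) → Subset n
contractT u v u≢v T = tabulate λ w → f w (w ≟ merge u v u≢v u)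
  where
  f : (w : Fin _) → Dec (w ≡ merge u v u≢v u) → Bool
  f w (yes _) = lookup T u xor lookup T v   -- |T ∩ {u,v}| = 1
  f w (no _)  = lookup T (punchIn v w)

data Step : Graft → Graft → Set where
  deleteEdge : ∀ {n m} (ends : Fin (suc m) → Fin n × Fin n) (T : Subset n)
    (e : Fin (suc m)) →
    Step (graft n (suc m) ends T) (graft n m (ends ∘ punchIn e) T)
  deleteIsolated : ∀ {n m} (ends : Fin m → Fin (suc n) × Fin (suc n))
    (T : Subset (suc n)) (v : Fin (suc n))
    (iso : ∀ e → (v ≢ proj₁ (ends e)) × (v ≢ proj₂ (ends e))) →
    Step (graft (suc n) m ends T)
         (graft n m (λ e → punchOut (proj₁ (iso e)) , punchOut (proj₂ (iso e)))
                    (removeAt T v))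
  contractLoop : ∀ {n m} (ends : Fin (suc m) → Fin n × Fin n) (T : Subset n)
    (e : Fin (suc m)) → proj₁ (ends e) ≡ proj₂ (ends e) →
    Step (graft n (suc m) ends T) (graft n m (ends ∘ punchIn e) T)
  contractEdge : ∀ {n m} (ends : Fin (suc m) → Fin (suc n) × Fin (suc n))
    (T : Subset (suc n)) (e : Fin (suc m))
    (ne : proj₁ (ends e) ≢ proj₂ (ends e)) →
    Step (graft (suc n) (suc m) ends T)
         (graft n m
           (λ f → mapPair (merge (proj₁ (ends e)) (proj₂ (ends e)) ne)
                          (ends (punchIn e f)))
           (contractT (proj₁ (ends e)) (proj₂ (ends e)) ne T))

_≼_ : Graft → Graft → Set
H ≼ G = Star Step G H

-- A cyclic decomposition is determined by its bags: H can be rebuilt with one edge for each vertex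
-- shared by two bags, oriented by the bipartition. So (C1)-(C4) become conditions on the bags alone:
-- they cover the vertices and the edges of G, shared vertices are terminals lying in bags of different
-- colours, and every bag x has at most two terminals and Σ_{y ≢ x} |B x ∩ B y| ≤ 2 (its degree in H).
-- These conditions survive restricting the bags along an injective relabelling of the vertices, which
-- handles the deletions. When an edge uv is contracted, a non-terminal end lies in a single bag, which
-- contains the other end as well, so that end can simply be renamed into the other one. If u and v are
-- both terminals, all bags meeting uv are first merged into one; double counting over the merged bags,
-- each of degree at most two, shows that the merged bag again has degree at most two and at most four
-- terminals, two of which (u and v) disappear in the contraction.

module Submission where

open import Defs

open import Data.Nat.Properties
  using (+-*-semiring; +-comm; +-identityʳ; *-comm; *-assoc; *-identityˡ; *-identityʳ; *-zeroʳ; *-distribʳ-+;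
         ≤-refl; ≤-reflexive; ≤-trans; ≤⇒≯; m≤m+n; m≤m*n; n>0⇒n≢0; 1+n≢0; m+[n∸m]≡n;
         +-mono-≤; +-monoˡ-≤; +-monoʳ-≤; *-mono-≤; *-monoˡ-≤; *-monoʳ-≤; ∸-monoˡ-≤; +-cancelʳ-≤; module ≤-Reasoning)
open import Algebra.Properties.Semiring.Sum +-*-semiring
  using (sum; sum-syntax; sum-cong-≗; sum-remove; sum-replicate-zero; ∑-distrib-+; ∑-comm; *-distribˡ-sum; *-distribʳ-sum)
open import Data.Bool using (Bool; true; false; _∧_; _∨_; not; _xor_; if_then_else_)
import Data.Bool as B
open import Data.Bool.Properties
  using (∧-comm; ∧-conicalˡ; ∧-conicalʳ; ∧-zeroʳ; ∧-identityʳ; ∨-zeroʳ; not-involutive; not-¬; ¬-not)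
open import Data.Empty using (⊥)
open import Data.List as List using (List; []; _∷_; _++_; length)
open import Data.List.Properties using (map-++)
open import Data.Nat.ListAction using () renaming (sum to sumᴸ)
open import Data.Nat.ListAction.Properties using () renaming (sum-++ to sumᴸ-++)
open import Data.Fin.Subset using (Subset; _∈_; _∩_; _⊆_; ∣_∣)
open import Data.Vec using (Vec; lookup; tabulate; removeAt; []; _∷_)
open import Data.Vec.Properties using (lookup-zipWith; lookup∘tabulate; removeAt-punchOut; []=⇒lookup; lookup⇒[]=)
open import Data.Fin using (Fin; zero; suc; _≟_; punchIn; punchOut)
open import Data.Fin.Properties
  using (any?; 0≢1+n; suc-injective; punchIn-injective; punchInᵢ≢i; punchIn-punchOut; punchOut-punchIn; punchOut-cong;
         punchOut-injective)
open import Data.Nat using (ℕ; zero; suc; _+_; _*_; _∸_; _≤_; z≤n; s≤s; s≤s⁻¹)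
open import Data.Nat.Tactic.RingSolver using (solve-∀)
open import Data.Product using (Σ; ∃; _×_; _,_; proj₁; proj₂; map; map₂)
open import Data.Sum using (_⊎_; inj₁; inj₂)
open import Function using (_∘_; _∋_; id)
open import Function.Definitions using (Injective)
open import Relation.Nullary using (¬_; Dec; yes; no; does; contradiction)
open import Relation.Nullary.Decidable using (_×-dec_; _⊎-dec_; ¬?; dec-true; dec-false)
open import Relation.Binary.PropositionalEquality
open import Relation.Binary.Construct.Closure.ReflexiveTransitive using (fold)

⟦_⟧ : Bool → ℕ
⟦ true ⟧  = 1
⟦ false ⟧ = 0

⟦⟧-≢true : ∀ {b} → b ≢ true → ⟦ b ⟧ ≡ 0
⟦⟧-≢true {false} _ = refl
⟦⟧-≢true {true}  b≢true = contradiction refl b≢true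

⟦⟧-∧-implied : ∀ {a b} → (b ≡ true → a ≡ true) → ⟦ a ∧ b ⟧ ≡ ⟦ b ⟧
⟦⟧-∧-implied {a} {false} _   = cong ⟦_⟧ (∧-zeroʳ a)
⟦⟧-∧-implied {a} {true}  b⇒a = cong (λ c → ⟦ c ∧ true ⟧) (b⇒a refl)

⟦⟧-∨+∧ : ∀ a b → ⟦ a ∨ b ⟧ + ⟦ a ∧ b ⟧ ≡ ⟦ a ⟧ + ⟦ b ⟧
⟦⟧-∨+∧ true  b = refl
⟦⟧-∨+∧ false b = +-identityʳ ⟦ b ⟧

⟦⟧-mono : ∀ {a b} → (a ≡ true → b ≡ true) → ⟦ a ⟧ ≤ ⟦ b ⟧
⟦⟧-mono {false} _   = z≤n
⟦⟧-mono {true}  a⇒b = ≤-reflexive (cong ⟦_⟧ (sym (a⇒b refl)))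

xor-false : ∀ a {b} → b ≡ false → a xor b ≡ a
xor-false true  refl = refl
xor-false false refl = refl

⟦⟧-∧ : ∀ a b → ⟦ a ∧ b ⟧ ≡ ⟦ a ⟧ * ⟦ b ⟧
⟦⟧-∧ true  b = sym (+-identityʳ ⟦ b ⟧)
⟦⟧-∧ false b = refl

ind-*-≤ : ∀ {P : Set} (p : Dec P) c → ind p * c ≤ c
ind-*-≤ (yes _) c = ≤-reflexive (*-identityˡ c)
ind-*-≤ (no _)  c = z≤n

ind-×-dec : ∀ {P Q : Set} (p : Dec P) (q : Dec Q) → ind (p ×-dec q) ≡ ind p * ind q
ind-×-dec (yes _) (yes _) = refl
ind-×-dec (yes _) (no _)  = refl
ind-×-dec (no _)  _       = refl

ind-⊎-dec-≤ : ∀ {P Q : Set} (p : Dec P) (q : Dec Q) → ind (p ⊎-dec q) ≤ ind p + ind q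
ind-⊎-dec-≤ (yes _) _       = s≤s z≤n
ind-⊎-dec-≤ (no _)  (yes _) = ≤-refl
ind-⊎-dec-≤ (no _)  (no _)  = z≤n

ind-⊎-dec-disjoint : ∀ {P Q : Set} (p : Dec P) (q : Dec Q) → (P → Q → ⊥) →
                     ind (p ⊎-dec q) ≡ ind p + ind q
ind-⊎-dec-disjoint (yes p) (yes q) p⊥q = contradiction q (p⊥q p)
ind-⊎-dec-disjoint (yes _) (no _)  _   = refl
ind-⊎-dec-disjoint (no _)  (yes _) _   = refl
ind-⊎-dec-disjoint (no _)  (no _)  _   = refl

sumFin≡sum : ∀ {n} (f : Fin n → ℕ) → sumFin f ≡ sum f
sumFin≡sum {zero}  f = refl
sumFin≡sum {suc n} f = cong (f zero +_) (sumFin≡sum (f ∘ suc))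

∑-mono-≤ : ∀ {n} {f g : Fin n → ℕ} → (∀ i → f i ≤ g i) → sum f ≤ sum g
∑-mono-≤ {zero}  _   = z≤n
∑-mono-≤ {suc n} f≤g = +-mono-≤ (f≤g zero) (∑-mono-≤ (f≤g ∘ suc))

∑-zero : ∀ {n} {f : Fin n → ℕ} → (∀ i → f i ≡ 0) → sum f ≡ 0
∑-zero {n} f≗0 = trans (sum-cong-≗ f≗0) (sum-replicate-zero n)

∑-concentrated : ∀ {n} (f : Fin n → ℕ) (x : Fin n) → (∀ i → i ≢ x → f i ≡ 0) → sum f ≡ f x
∑-concentrated {suc n} f x vanishes = begin
  sum f                          ≡⟨ sum-remove {i = x} f ⟩
  f x + sum (f ∘ punchIn x)      ≡⟨ cong (f x +_) (∑-zero (λ j → vanishes (punchIn x j) (punchInᵢ≢i x j))) ⟩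
  f x + 0                        ≡⟨ +-identityʳ (f x) ⟩
  f x                            ∎
  where open ≡-Reasoning

∑-δ : ∀ {n} (x : Fin n) (f : Fin n → ℕ) → ∑[ i < n ] (ind (i ≟ x) * f i) ≡ f x
∑-δ x f = trans (∑-concentrated _ x off-x) on-x
  where
  off-x : ∀ i → i ≢ x → ind (i ≟ x) * f i ≡ 0
  off-x i i≢x with i ≟ x
  ... | yes i≡x = contradiction i≡x i≢x
  ... | no _    = refl
  on-x : ind (x ≟ x) * f x ≡ f x
  on-x with x ≟ x
  ... | yes _   = +-identityʳ (f x)
  ... | no x≢x  = contradiction refl x≢x

∑-ind-≟ : ∀ {n} (x : Fin n) → ∑[ i < n ] ind (x ≟ i) ≡ 1
∑-ind-≟ x = trans (sum-cong-≗ flip) (∑-δ x (λ _ → 1))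
  where
  flip : ∀ i → ind (x ≟ i) ≡ ind (i ≟ x) * 1
  flip i with x ≟ i | i ≟ x
  ... | yes _   | yes _   = refl
  ... | no _    | no _    = refl
  ... | yes x≡i | no i≢x  = contradiction (sym x≡i) i≢x
  ... | no x≢i  | yes i≡x = contradiction (sym i≡x) x≢i

≤-∑ : ∀ {n} (f : Fin n → ℕ) (x : Fin n) → f x ≤ sum f
≤-∑ {suc n} f x = subst (f x ≤_) (sym (sum-remove {i = x} f)) (m≤m+n (f x) _)

∑-injective-≤ : ∀ {m n} (f : Fin n → ℕ) {g : Fin m → Fin n} →
                Injective _≡_ _≡_ g → sum (f ∘ g) ≤ sum f
∑-injective-≤ {zero}          f     _   = z≤n
∑-injective-≤ {suc m} {zero}  f {g} _   with g zero
... | ()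
∑-injective-≤ {suc m} {suc n} f {g} inj = begin
  f x + sum (f ∘ g ∘ suc)                ≡⟨ cong (f x +_) (sum-cong-≗ (λ i → cong f (sym (punchIn-punchOut (apart i))))) ⟩
  f x + sum (f ∘ punchIn x ∘ h)          ≤⟨ +-monoʳ-≤ (f x) (∑-injective-≤ (f ∘ punchIn x) h-injective) ⟩
  f x + sum (f ∘ punchIn x)              ≡⟨ sum-remove {i = x} f ⟨
  sum f                                  ∎
  where
  open ≤-Reasoning
  x = g zero
  apart : ∀ i → x ≢ g (suc i)
  apart i = 0≢1+n ∘ inj
  h : Fin m → Fin n
  h i = punchOut (apart i)
  h-injective : Injective _≡_ _≡_ h
  h-injective {i} {j} = suc-injective ∘ inj ∘ punchOut-injective (apart i) (apart j)

∑-two-≤ : ∀ {n} (f : Fin n → ℕ) {x y : Fin n} → x ≢ y → f x + f y ≤ sum f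
∑-two-≤ {suc n} f {x} {y} x≢y = begin
  f x + f y                                  ≡⟨ cong (λ z → f x + f z) (punchIn-punchOut x≢y) ⟨
  f x + f (punchIn x (punchOut x≢y))         ≤⟨ +-monoʳ-≤ (f x) (≤-∑ (f ∘ punchIn x) (punchOut x≢y)) ⟩
  f x + sum (f ∘ punchIn x)                  ≡⟨ sum-remove {i = x} f ⟨
  sum f                                      ∎
  where open ≤-Reasoning

∑-three-≤ : ∀ {n} (f : Fin n → ℕ) {x y z : Fin n} → x ≢ y → x ≢ z → y ≢ z →
            f x + (f y + f z) ≤ sum f
∑-three-≤ {suc n} f {x} {y} {z} x≢y x≢z y≢z = begin
  f x + (f y + f z)                              ≡⟨ cong₂ (λ a b → f x + (f a + f b)) (punchIn-punchOut x≢y) (punchIn-punchOut x≢z) ⟨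
  f x + (f (punchIn x y′) + f (punchIn x z′))    ≤⟨ +-monoʳ-≤ (f x) (∑-two-≤ (f ∘ punchIn x) (y≢z ∘ punchOut-injective x≢y x≢z)) ⟩
  f x + sum (f ∘ punchIn x)                      ≡⟨ sum-remove {i = x} f ⟨
  sum f                                          ∎
  where
  open ≤-Reasoning
  y′ = punchOut x≢y
  z′ = punchOut x≢z

nonzero-term : ∀ {n} (f : Fin n → ℕ) → sum f ≢ 0 → ∃ λ i → f i ≢ 0
nonzero-term {zero}  f ∑f≢0 = contradiction refl ∑f≢0
nonzero-term {suc n} f ∑f≢0 with f zero in f0≡1+
... | suc _ = zero , λ f0≡0 → 1+n≢0 (trans (sym f0≡1+) f0≡0)
... | zero  with nonzero-term (f ∘ suc) ∑f≢0
...   | i , fi≢0 = suc i , fi≢0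

ind-nonzero : ∀ {P : Set} (p : Dec P) → ind p ≢ 0 → P
ind-nonzero (yes p) _  = p
ind-nonzero (no _)  ≢0 = contradiction refl ≢0

-- Bag systems

Bags : ℕ → ℕ → Set
Bags k n = Fin k → Fin n → Bool

module _ {k n : ℕ} (bag : Bags k n) where

  multiplicity : Fin n → ℕ
  multiplicity w = ∑[ y < k ] ⟦ bag y w ⟧

  weight : (Fin n → ℕ) → Fin k → ℕ
  weight h x = ∑[ w < n ] (⟦ bag x w ⟧ * h w)

  -- overlaps x = Σ_{y ≢ x} ∣ bag x ∩ bag y ∣, the degree of x in the graph H of a cyclic decomposition
  overlaps : Fin k → ℕ
  overlaps = weight (λ w → multiplicity w ∸ 1)

∑-sharing : ∀ {k n} (bag : Bags k n) x w (h : Fin k → ℕ) → h x ≡ 0 → (∀ y → y ≢ x → h y ≡ ⟦ bag x w ∧ bag y w ⟧) →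
            sum h ≡ ⟦ bag x w ⟧ * (multiplicity bag w ∸ 1)
∑-sharing {suc k} bag x w h hx≡0 hy = begin
  sum h                                                  ≡⟨ sum-remove {i = x} h ⟩
  h x + sum (h ∘ punchIn x)                              ≡⟨ cong₂ _+_ hx≡0 (sum-cong-≗ (λ j → hy _ (punchInᵢ≢i x j))) ⟩
  ∑[ j < k ] ⟦ bag x w ∧ bag (punchIn x j) w ⟧           ≡⟨ by-membership (bag x w) ⟩
  ⟦ bag x w ⟧ * (⟦ bag x w ⟧ + others ∸ 1)               ≡⟨ cong (λ s → ⟦ bag x w ⟧ * (s ∸ 1))
                                                                 (sum-remove {i = x} (λ y → ⟦ bag y w ⟧)) ⟨
  ⟦ bag x w ⟧ * (multiplicity bag w ∸ 1)                 ∎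
  where
  open ≡-Reasoning
  others = ∑[ j < k ] ⟦ bag (punchIn x j) w ⟧
  by-membership : ∀ b → ∑[ j < k ] ⟦ b ∧ bag (punchIn x j) w ⟧ ≡ ⟦ b ⟧ * (⟦ b ⟧ + others ∸ 1)
  by-membership true  = sym (+-identityʳ others)
  by-membership false = ∑-zero {k} (λ _ → refl)

Spans : ∀ {k n m} → Bags k n → (Fin m → Fin n × Fin n) → Set
Spans bag ends = ∀ e → ∃ λ x → bag x (proj₁ (ends e)) ≡ true × bag x (proj₂ (ends e)) ≡ true

-- The bags of a cyclic decomposition and the bipartition of H; H itself is rebuilt in cyclicDecomposition.
record BagSystem {n m : ℕ} (ends : Fin m → Fin n × Fin n) (terminal : Fin n → Bool) : Set where
  field
    k               : ℕ
    bag             : Bags k n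
    colour          : Fin k → Bool
    covers          : ∀ w → ∃ λ x → bag x w ≡ true
    spans           : Spans bag ends
    shared⇒terminal : ∀ {x y w} → x ≢ y → bag x w ≡ true → bag y w ≡ true → terminal w ≡ true
    shared⇒colour≢  : ∀ {x y w} → x ≢ y → bag x w ≡ true → bag y w ≡ true → colour x ≢ colour y
    overlaps≤2       : ∀ x → overlaps bag x ≤ 2
    terminals≤2     : ∀ x → weight bag (⟦_⟧ ∘ terminal) x ≤ 2

BagSystemOf : Graft → Set
BagSystemOf G = BagSystem (Graft.ends G) (lookup (Graft.T G))

nonterminal⇒private : ∀ {n m} {ends : Fin m → Fin n × Fin n} {terminal} (S : BagSystem ends terminal) {x x₀ a} →
                      terminal a ≡ false → BagSystem.bag S x₀ a ≡ true → BagSystem.bag S x a ≡ true → x ≡ x₀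
nonterminal⇒private S {x} {x₀} a∉T x₀∋a x∋a with x ≟ x₀
... | yes x≡x₀ = x≡x₀
... | no x≢x₀  = contradiction (trans (sym a∉T) (BagSystem.shared⇒terminal S x≢x₀ x∋a x₀∋a)) λ ()

-- Cyclic decompositions as bag systems

Joins : ∀ {k} → Fin k × Fin k → Fin k → Fin k → Set
Joins p x y = (proj₁ p ≡ x × proj₂ p ≡ y) ⊎ (proj₁ p ≡ y × proj₂ p ≡ x)

joins? : ∀ {k} (p : Fin k × Fin k) x y → Dec (Joins p x y)
joins? p x y = ((proj₁ p ≟ x) ×-dec (proj₂ p ≟ y)) ⊎-dec ((proj₁ p ≟ y) ×-dec (proj₂ p ≟ x))

incidence : ∀ {k} → Fin k × Fin k → Fin k → ℕ
incidence p x = ind (proj₁ p ≟ x) + ind (proj₂ p ≟ x)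

edgesBetween≡∑ : ∀ {k p} (hends : Fin p → Fin k × Fin k) x y →
                 edgesBetween hends x y ≡ ∑[ e < p ] ind (joins? (hends e) x y)
edgesBetween≡∑ hends x y = sumFin≡sum (λ e → ind (joins? (hends e) x y))

degree≡∑ : ∀ {k p} (hends : Fin p → Fin k × Fin k) x → degree hends x ≡ ∑[ e < p ] incidence (hends e) x
degree≡∑ hends x = sumFin≡sum (λ e → incidence (hends e) x)

∑-joins≤incidence : ∀ {k} (p : Fin k × Fin k) x → ∑[ y < k ] ind (joins? p x y) ≤ incidence p x
∑-joins≤incidence {k} (a , b) x = begin
  ∑[ y < k ] ind (joins? (a , b) x y)
    ≤⟨ ∑-mono-≤ (λ y → ind-⊎-dec-≤ ((a ≟ x) ×-dec (b ≟ y)) ((a ≟ y) ×-dec (b ≟ x))) ⟩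
  ∑[ y < k ] (ind ((a ≟ x) ×-dec (b ≟ y)) + ind ((a ≟ y) ×-dec (b ≟ x)))
    ≡⟨ sum-cong-≗ (λ y → cong₂ _+_ (ind-×-dec (a ≟ x) (b ≟ y)) (ind-×-dec (a ≟ y) (b ≟ x))) ⟩
  ∑[ y < k ] (ind (a ≟ x) * ind (b ≟ y) + ind (a ≟ y) * ind (b ≟ x))
    ≡⟨ ∑-distrib-+ (λ y → ind (a ≟ x) * ind (b ≟ y)) (λ y → ind (a ≟ y) * ind (b ≟ x)) ⟩
  ∑[ y < k ] (ind (a ≟ x) * ind (b ≟ y)) + ∑[ y < k ] (ind (a ≟ y) * ind (b ≟ x))
    ≡⟨ cong₂ _+_ (*-distribˡ-sum (ind (a ≟ x)) (λ y → ind (b ≟ y)))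
                 (*-distribʳ-sum (ind (b ≟ x)) (λ y → ind (a ≟ y))) ⟨
  ind (a ≟ x) * ∑[ y < k ] ind (b ≟ y) + ∑[ y < k ] ind (a ≟ y) * ind (b ≟ x)
    ≡⟨ cong₂ (λ s t → ind (a ≟ x) * s + t * ind (b ≟ x)) (∑-ind-≟ b) (∑-ind-≟ a) ⟩
  ind (a ≟ x) * 1 + 1 * ind (b ≟ x)
    ≡⟨ cong₂ _+_ (*-identityʳ (ind (a ≟ x))) (*-identityˡ (ind (b ≟ x))) ⟩
  incidence (a , b) x ∎
  where open ≤-Reasoning

∑∑-incidence : ∀ {k} (f : Fin k → Fin k → ℕ) x →
               ∑[ a < k ] ∑[ b < k ] (f a b * incidence (a , b) x) ≡ ∑[ y < k ] (f x y + f y x)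
∑∑-incidence {k} f x = begin
  ∑[ a < k ] ∑[ b < k ] (f a b * incidence (a , b) x)
    ≡⟨ sum-cong-≗ (λ a → sum-cong-≗ (λ b → split a b)) ⟩
  ∑[ a < k ] ∑[ b < k ] (ind (a ≟ x) * f a b + ind (b ≟ x) * f a b)
    ≡⟨ sum-cong-≗ (λ a → ∑-distrib-+ (λ b → ind (a ≟ x) * f a b) (λ b → ind (b ≟ x) * f a b)) ⟩
  ∑[ a < k ] (∑[ b < k ] (ind (a ≟ x) * f a b) + ∑[ b < k ] (ind (b ≟ x) * f a b))
    ≡⟨ ∑-distrib-+ (λ a → ∑[ b < k ] (ind (a ≟ x) * f a b)) (λ a → ∑[ b < k ] (ind (b ≟ x) * f a b)) ⟩
  ∑[ a < k ] ∑[ b < k ] (ind (a ≟ x) * f a b) + ∑[ a < k ] ∑[ b < k ] (ind (b ≟ x) * f a b)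
    ≡⟨ cong₂ _+_ (sum-cong-≗ (λ a → *-distribˡ-sum (ind (a ≟ x)) (f a))) (sym (sum-cong-≗ (λ a → ∑-δ x (f a)))) ⟨
  ∑[ a < k ] (ind (a ≟ x) * ∑[ b < k ] f a b) + ∑[ a < k ] f a x
    ≡⟨ cong (_+ ∑[ a < k ] f a x) (∑-δ x (λ a → ∑[ b < k ] f a b)) ⟩
  ∑[ y < k ] f x y + ∑[ y < k ] f y x
    ≡⟨ ∑-distrib-+ (f x) (λ y → f y x) ⟨
  ∑[ y < k ] (f x y + f y x) ∎
  where
  open ≡-Reasoning
  split : ∀ a b → f a b * incidence (a , b) x ≡ ind (a ≟ x) * f a b + ind (b ≟ x) * f a b
  split a b = trans (*-comm (f a b) _) (*-distribʳ-+ (f a b) (ind (a ≟ x)) (ind (b ≟ x)))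

∑∑-δ : ∀ {k} (f : Fin k → Fin k → ℕ) s t →
       ∑[ a < k ] ∑[ b < k ] ((ind (a ≟ s) * ind (b ≟ t)) * f a b) ≡ f s t
∑∑-δ {k} f s t = begin
  ∑[ a < k ] ∑[ b < k ] ((ind (a ≟ s) * ind (b ≟ t)) * f a b)
    ≡⟨ sum-cong-≗ (λ a → sum-cong-≗ (λ b → *-assoc (ind (a ≟ s)) (ind (b ≟ t)) (f a b))) ⟩
  ∑[ a < k ] ∑[ b < k ] (ind (a ≟ s) * (ind (b ≟ t) * f a b))
    ≡⟨ sum-cong-≗ (λ a → *-distribˡ-sum (ind (a ≟ s)) (λ b → ind (b ≟ t) * f a b)) ⟨
  ∑[ a < k ] (ind (a ≟ s) * ∑[ b < k ] (ind (b ≟ t) * f a b))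
    ≡⟨ sum-cong-≗ (λ a → cong (ind (a ≟ s) *_) (∑-δ t (f a))) ⟩
  ∑[ a < k ] (ind (a ≟ s) * f a t)
    ≡⟨ ∑-δ s (λ a → f a t) ⟩
  f s t ∎
  where open ≡-Reasoning

∑∑-joins : ∀ {k} (f : Fin k → Fin k → ℕ) {x y} → x ≢ y →
           ∑[ a < k ] ∑[ b < k ] (f a b * ind (joins? (a , b) x y)) ≡ f x y + f y x
∑∑-joins {k} f {x} {y} x≢y = begin
  ∑[ a < k ] ∑[ b < k ] (f a b * ind (joins? (a , b) x y))
    ≡⟨ sum-cong-≗ (λ a → sum-cong-≗ (λ b → split a b)) ⟩
  ∑[ a < k ] ∑[ b < k ] (δ x y a b * f a b + δ y x a b * f a b)
    ≡⟨ sum-cong-≗ (λ a → ∑-distrib-+ (λ b → δ x y a b * f a b) (λ b → δ y x a b * f a b)) ⟩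
  ∑[ a < k ] (∑[ b < k ] (δ x y a b * f a b) + ∑[ b < k ] (δ y x a b * f a b))
    ≡⟨ ∑-distrib-+ (λ a → ∑[ b < k ] (δ x y a b * f a b)) (λ a → ∑[ b < k ] (δ y x a b * f a b)) ⟩
  ∑[ a < k ] ∑[ b < k ] (δ x y a b * f a b) + ∑[ a < k ] ∑[ b < k ] (δ y x a b * f a b)
    ≡⟨ cong₂ _+_ (∑∑-δ f x y) (∑∑-δ f y x) ⟩
  f x y + f y x ∎
  where
  open ≡-Reasoning
  δ : Fin k → Fin k → Fin k → Fin k → ℕ
  δ s t a b = ind (a ≟ s) * ind (b ≟ t)
  split : ∀ a b → f a b * ind (joins? (a , b) x y) ≡ δ x y a b * f a b + δ y x a b * f a b
  split a b = begin
    f a b * ind (joins? (a , b) x y)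
      ≡⟨ *-comm (f a b) _ ⟩
    ind (joins? (a , b) x y) * f a b
      ≡⟨ cong (_* f a b) (ind-⊎-dec-disjoint ((a ≟ x) ×-dec (b ≟ y)) ((a ≟ y) ×-dec (b ≟ x))
                            (λ { (refl , _) (a≡y , _) → x≢y a≡y })) ⟩
    (ind ((a ≟ x) ×-dec (b ≟ y)) + ind ((a ≟ y) ×-dec (b ≟ x))) * f a b
      ≡⟨ cong (_* f a b) (cong₂ _+_ (ind-×-dec (a ≟ x) (b ≟ y)) (ind-×-dec (a ≟ y) (b ≟ x))) ⟩
    (δ x y a b + δ y x a b) * f a b
      ≡⟨ *-distribʳ-+ (f a b) (δ x y a b) (δ y x a b) ⟩
    δ x y a b * f a b + δ y x a b * f a b ∎

joins⇒colour≢ : ∀ {k} {colour : Fin k → Bool} {p : Fin k × Fin k} {x y} →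
                colour (proj₁ p) ≢ colour (proj₂ p) → Joins p x y → colour x ≢ colour y
joins⇒colour≢ c≢ (inj₁ (refl , refl)) = c≢
joins⇒colour≢ c≢ (inj₂ (refl , refl)) = c≢ ∘ sym

lookup-∩ : ∀ {n} (p q : Subset n) w → lookup (p ∩ q) w ≡ lookup p w ∧ lookup q w
lookup-∩ p q w = lookup-zipWith _∧_ w p q

∣∣≡∑ : ∀ {n} (p : Subset n) → ∣ p ∣ ≡ ∑[ i < n ] ⟦ lookup p i ⟧
∣∣≡∑ []          = refl
∣∣≡∑ (true ∷ p)  = cong suc (∣∣≡∑ p)
∣∣≡∑ (false ∷ p) = ∣∣≡∑ p

∣∩∣≡∑ : ∀ {n} (p q : Subset n) → ∣ p ∩ q ∣ ≡ ∑[ i < n ] ⟦ lookup p i ∧ lookup q i ⟧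
∣∩∣≡∑ p q = trans (∣∣≡∑ (p ∩ q)) (sum-cong-≗ (cong ⟦_⟧ ∘ lookup-∩ p q))

bagSystem : (G : Graft) → CyclicDecomposition G → BagSystemOf G
bagSystem G D = record
  { k               = k
  ; bag             = bag
  ; colour          = proj₁ bip
  ; covers          = map₂ []=⇒lookup ∘ C1
  ; spans           = map₂ (map []=⇒lookup []=⇒lookup) ∘ C2
  ; shared⇒terminal = λ {x} {y} x≢y x∋w y∋w → []=⇒lookup (proj₁ (C3 x y x≢y) (∈-∩ x∋w y∋w))
  ; shared⇒colour≢  = shared⇒colour≢
  ; overlaps≤2      = overlaps≤2
  ; terminals≤2     = λ x → subst (_≤ 2) (∣T∩B∣≡weight x) (C4 x)
  }
  where
  open Graft G
  open CyclicDecomposition D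

  bag : Bags k n
  bag x = lookup (B x)

  ∈-∩ : ∀ {x y w} → bag x w ≡ true → bag y w ≡ true → w ∈ B x ∩ B y
  ∈-∩ {x} {y} {w} x∋w y∋w = lookup⇒[]= w (B x ∩ B y) (trans (lookup-∩ (B x) (B y) w) (cong₂ _∧_ x∋w y∋w))

  shared⇒colour≢ : ∀ {x y w} → x ≢ y → bag x w ≡ true → bag y w ≡ true → proj₁ bip x ≢ proj₁ bip y
  shared⇒colour≢ {x} {y} {w} x≢y x∋w y∋w =
    joins⇒colour≢ (proj₂ bip e) (ind-nonzero (joins? (hends e) x y) e-joins)
    where
    open ≡-Reasoning
    shared : ∑[ v < n ] ⟦ bag x v ∧ bag y v ⟧ ≢ 0
    shared = n>0⇒n≢0 (subst (_≤ _) (cong₂ (λ a b → ⟦ a ∧ b ⟧) x∋w y∋w) (≤-∑ (λ v → ⟦ bag x v ∧ bag y v ⟧) w))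
    edges : ∑[ e < p ] ind (joins? (hends e) x y) ≢ 0
    edges = subst (_≢ 0) (begin
      ∑[ v < n ] ⟦ bag x v ∧ bag y v ⟧               ≡⟨ ∣∩∣≡∑ (B x) (B y) ⟨
      ∣ B x ∩ B y ∣                                  ≡⟨ proj₂ (C3 x y x≢y) ⟩
      edgesBetween hends x y                         ≡⟨ edgesBetween≡∑ hends x y ⟩
      ∑[ e < p ] ind (joins? (hends e) x y)          ∎) shared
    found = nonzero-term (λ e → ind (joins? (hends e) x y)) edges
    e = proj₁ found
    e-joins = proj₂ found

  distinct : Fin k → Fin k → ℕ
  distinct y x = ind (¬? (y ≟ x))

  distinct-self : ∀ x c → distinct x x * c ≡ 0
  distinct-self x c with x ≟ x
  ... | yes _   = refl
  ... | no x≢x  = contradiction refl x≢x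

  distinct-other : ∀ {y x} c → y ≢ x → distinct y x * c ≡ c
  distinct-other {y} {x} c y≢x with y ≟ x
  ... | yes y≡x = contradiction y≡x y≢x
  ... | no _    = *-identityˡ c

  ∣B∩B∣≡edgesBetween : ∀ x y → distinct y x * ∣ B x ∩ B y ∣ ≡ distinct y x * edgesBetween hends x y
  ∣B∩B∣≡edgesBetween x y with y ≟ x
  ... | yes _   = refl
  ... | no y≢x  = cong (1 *_) (proj₂ (C3 x y (y≢x ∘ sym)))

  overlaps≤2 : ∀ x → overlaps bag x ≤ 2
  overlaps≤2 x = begin
    overlaps bag x
      ≡⟨ sum-cong-≗ (λ w → ∑-sharing bag x w _ (distinct-self x _) (λ y → distinct-other _)) ⟨
    ∑[ w < n ] ∑[ y < k ] (distinct y x * ⟦ bag x w ∧ bag y w ⟧)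
      ≡⟨ ∑-comm (λ w y → distinct y x * ⟦ bag x w ∧ bag y w ⟧) ⟩
    ∑[ y < k ] ∑[ w < n ] (distinct y x * ⟦ bag x w ∧ bag y w ⟧)
      ≡⟨ sum-cong-≗ (λ y → *-distribˡ-sum (distinct y x) (λ w → ⟦ bag x w ∧ bag y w ⟧)) ⟨
    ∑[ y < k ] (distinct y x * ∑[ w < n ] ⟦ bag x w ∧ bag y w ⟧)
      ≡⟨ sum-cong-≗ (λ y → cong (distinct y x *_) (∣∩∣≡∑ (B x) (B y))) ⟨
    ∑[ y < k ] (distinct y x * ∣ B x ∩ B y ∣)
      ≡⟨ sum-cong-≗ (∣B∩B∣≡edgesBetween x) ⟩
    ∑[ y < k ] (distinct y x * edgesBetween hends x y)
      ≤⟨ ∑-mono-≤ (λ y → ind-*-≤ (¬? (y ≟ x)) _) ⟩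
    ∑[ y < k ] edgesBetween hends x y
      ≡⟨ sum-cong-≗ (edgesBetween≡∑ hends x) ⟩
    ∑[ y < k ] ∑[ e < p ] ind (joins? (hends e) x y)
      ≡⟨ ∑-comm (λ y e → ind (joins? (hends e) x y)) ⟩
    ∑[ e < p ] ∑[ y < k ] ind (joins? (hends e) x y)
      ≤⟨ ∑-mono-≤ (λ e → ∑-joins≤incidence (hends e) x) ⟩
    ∑[ e < p ] incidence (hends e) x
      ≡⟨ degree≡∑ hends x ⟨
    degree hends x
      ≤⟨ maxdeg x ⟩
    2 ∎
    where open ≤-Reasoning

  ∣T∩B∣≡weight : ∀ x → ∣ T ∩ B x ∣ ≡ weight bag (⟦_⟧ ∘ lookup T) x
  ∣T∩B∣≡weight x = trans (∣∩∣≡∑ T (B x)) (sum-cong-≗ λ w →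
    trans (⟦⟧-∧ (lookup T w) (bag x w)) (*-comm ⟦ lookup T w ⟧ ⟦ bag x w ⟧))

∑-lookup : ∀ {A : Set} (g : A → ℕ) (xs : List A) → ∑[ i < length xs ] g (List.lookup xs i) ≡ sumᴸ (List.map g xs)
∑-lookup g []       = refl
∑-lookup g (x ∷ xs) = cong (g x +_) (∑-lookup g xs)

sumᴸ-concat-tabulate : ∀ {A : Set} {m} (g : A → ℕ) (F : Fin m → List A) →
                       sumᴸ (List.map g (List.concat (List.tabulate F))) ≡ ∑[ i < m ] sumᴸ (List.map g (F i))
sumᴸ-concat-tabulate {m = zero}  g F = refl
sumᴸ-concat-tabulate {m = suc m} g F = begin
  sumᴸ (List.map g (F zero ++ rest))                      ≡⟨ cong sumᴸ (map-++ g (F zero) rest) ⟩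
  sumᴸ (List.map g (F zero) ++ List.map g rest)           ≡⟨ sumᴸ-++ (List.map g (F zero)) (List.map g rest) ⟩
  sumᴸ (List.map g (F zero)) + sumᴸ (List.map g rest)     ≡⟨ cong (sumᴸ (List.map g (F zero)) +_) (sumᴸ-concat-tabulate g (F ∘ suc)) ⟩
  ∑[ i < suc m ] sumᴸ (List.map g (F i))                  ∎
  where
  open ≡-Reasoning
  rest = List.concat (List.tabulate (F ∘ suc))

module _ {G : Graft} (S : BagSystemOf G) where
  open Graft G
  open BagSystem S

  private
    -- H gets an edge ab for each w ∈ bag a ∩ bag b, oriented from colour false to colour true
    oriented : Fin k → Fin k → Fin n → Bool
    oriented a b w = (not (colour a) ∧ colour b) ∧ (bag a w ∧ bag b w)

    oriented⇒colour≢ : ∀ c d r → (not c ∧ d) ∧ r ≡ true → c ≢ d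
    oriented⇒colour≢ false true  r _ = λ ()
    oriented⇒colour≢ false false r ()
    oriented⇒colour≢ true  d     r ()

    oriented-loop : ∀ x w → ⟦ oriented x x w ⟧ ≡ 0
    oriented-loop x w with colour x
    ... | true  = refl
    ... | false = refl

    unshared : ∀ {x y w} → x ≢ y → colour x ≡ colour y → bag x w ∧ bag y w ≢ true
    unshared x≢y same shared = shared⇒colour≢ x≢y (∧-conicalˡ _ _ shared) (∧-conicalʳ _ _ shared) same

    oriented-pair : ∀ {x y} w → x ≢ y → ⟦ oriented x y w ⟧ + ⟦ oriented y x w ⟧ ≡ ⟦ bag x w ∧ bag y w ⟧
    oriented-pair {x} {y} w x≢y with colour x in cx | colour y in cy
    ... | false | true  = +-identityʳ _
    ... | true  | false = cong ⟦_⟧ (∧-comm (bag y w) (bag x w))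
    ... | false | false = sym (⟦⟧-≢true (unshared x≢y (trans cx (sym cy))))
    ... | true  | true  = sym (⟦⟧-≢true (unshared x≢y (trans cx (sym cy))))

    BipartiteEdge : Set
    BipartiteEdge = Σ (Fin k × Fin k) λ p → colour (proj₁ p) ≢ colour (proj₂ p)

    edgeIf : ∀ a b o → (o ≡ true → colour a ≢ colour b) → List BipartiteEdge
    edgeIf a b true  c≢ = ((a , b) , c≢ refl) ∷ []
    edgeIf a b false _  = []

    sumᴸ-edgeIf : ∀ (g : Fin k × Fin k → ℕ) a b o c≢ →
                  sumᴸ (List.map (g ∘ proj₁) (edgeIf a b o c≢)) ≡ ⟦ o ⟧ * g (a , b)
    sumᴸ-edgeIf g a b true  _ = refl
    sumᴸ-edgeIf g a b false _ = refl

    edgeAt : Fin n → Fin k → Fin k → List BipartiteEdge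
    edgeAt w a b = edgeIf a b (oriented a b w) (oriented⇒colour≢ (colour a) (colour b) _)

    sumᴸ-edgeAt : ∀ (g : Fin k × Fin k → ℕ) w a b →
                  sumᴸ (List.map (g ∘ proj₁) (edgeAt w a b)) ≡ ⟦ oriented a b w ⟧ * g (a , b)
    sumᴸ-edgeAt g w a b = sumᴸ-edgeIf g a b (oriented a b w) (oriented⇒colour≢ (colour a) (colour b) _)

    edgesFrom : Fin n → Fin k → List BipartiteEdge
    edgesFrom w a = List.concat (List.tabulate (edgeAt w a))

    edgesThrough : Fin n → List BipartiteEdge
    edgesThrough w = List.concat (List.tabulate (edgesFrom w))

    edgeList : List BipartiteEdge
    edgeList = List.concat (List.tabulate edgesThrough)

    p : ℕ
    p = length edgeList

    hends : Fin p → Fin k × Fin k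
    hends = proj₁ ∘ List.lookup edgeList

    ∑-edges : (g : Fin k × Fin k → ℕ) →
              ∑[ e < p ] g (hends e) ≡ ∑[ w < n ] ∑[ a < k ] ∑[ b < k ] (⟦ oriented a b w ⟧ * g (a , b))
    ∑-edges g = begin
      ∑[ e < p ] g (hends e)
        ≡⟨ ∑-lookup g′ edgeList ⟩
      sumᴸ (List.map g′ edgeList)
        ≡⟨ sumᴸ-concat-tabulate g′ edgesThrough ⟩
      ∑[ w < n ] sumᴸ (List.map g′ (edgesThrough w))
        ≡⟨ sum-cong-≗ (λ w → sumᴸ-concat-tabulate g′ (edgesFrom w)) ⟩
      ∑[ w < n ] ∑[ a < k ] sumᴸ (List.map g′ (edgesFrom w a))
        ≡⟨ sum-cong-≗ (λ w → sum-cong-≗ λ a → sumᴸ-concat-tabulate g′ (edgeAt w a)) ⟩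
      ∑[ w < n ] ∑[ a < k ] ∑[ b < k ] sumᴸ (List.map g′ (edgeAt w a b))
        ≡⟨ sum-cong-≗ (λ w → sum-cong-≗ λ a → sum-cong-≗ λ b → sumᴸ-edgeAt g w a b) ⟩
      ∑[ w < n ] ∑[ a < k ] ∑[ b < k ] (⟦ oriented a b w ⟧ * g (a , b)) ∎
      where
      open ≡-Reasoning
      g′ = g ∘ proj₁

    ∑-orientations : ∀ x w → ∑[ y < k ] (⟦ oriented x y w ⟧ + ⟦ oriented y x w ⟧) ≡ ⟦ bag x w ⟧ * (multiplicity bag w ∸ 1)
    ∑-orientations x w = ∑-sharing bag x w (λ y → ⟦ oriented x y w ⟧ + ⟦ oriented y x w ⟧)
                           (cong₂ _+_ (oriented-loop x w) (oriented-loop x w)) (λ y y≢x → oriented-pair w (y≢x ∘ sym))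

    ∑-oriented-joins : ∀ {x y} → x ≢ y →
                       ∑[ e < p ] ind (joins? (hends e) x y) ≡ ∑[ w < n ] ⟦ bag x w ∧ bag y w ⟧
    ∑-oriented-joins {x} {y} x≢y = trans (∑-edges (λ q → ind (joins? q x y)))
      (sum-cong-≗ λ w → trans (∑∑-joins (λ a b → ⟦ oriented a b w ⟧) x≢y) (oriented-pair w x≢y))

    ∑-oriented-incidence : ∀ x → ∑[ e < p ] incidence (hends e) x ≡ overlaps bag x
    ∑-oriented-incidence x = trans (∑-edges (λ q → incidence q x))
      (sum-cong-≗ λ w → trans (∑∑-incidence (λ a b → ⟦ oriented a b w ⟧) x) (∑-orientations x w))

    Bag : Fin k → Subset n
    Bag x = tabulate (bag x)

    ∈-Bag : ∀ {x w} → bag x w ≡ true → w ∈ Bag x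
    ∈-Bag {x} {w} x∋w = lookup⇒[]= w (Bag x) (trans (lookup∘tabulate (bag x) w) x∋w)

    ∣∩Bag∣≡∑ : ∀ (q : Subset n) x → ∣ q ∩ Bag x ∣ ≡ ∑[ w < n ] ⟦ lookup q w ∧ bag x w ⟧
    ∣∩Bag∣≡∑ q x = trans (∣∩∣≡∑ q (Bag x))
                         (sum-cong-≗ λ w → cong (λ b → ⟦ lookup q w ∧ b ⟧) (lookup∘tabulate (bag x) w))

  cyclicDecomposition : CyclicDecomposition G
  cyclicDecomposition = record
    { k      = k
    ; p      = p
    ; hends  = hends
    ; bip    = colour , proj₂ ∘ List.lookup edgeList
    ; maxdeg = λ x → subst (_≤ 2) (sym (trans (degree≡∑ hends x) (∑-oriented-incidence x))) (overlaps≤2 x)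
    ; B      = Bag
    ; C1     = map₂ ∈-Bag ∘ covers
    ; C2     = map₂ (map ∈-Bag ∈-Bag) ∘ spans
    ; C3     = λ x y x≢y → shared-terminal x≢y , ∣Bag∩Bag∣ x≢y
    ; C4     = λ x → subst (_≤ 2) (sym (∣T∩Bag∣ x)) (terminals≤2 x)
    }
    where
    ∣T∩Bag∣ : ∀ x → ∣ T ∩ Bag x ∣ ≡ weight bag (⟦_⟧ ∘ lookup T) x
    ∣T∩Bag∣ x = trans (∣∩Bag∣≡∑ T x) (sum-cong-≗ λ w →
      trans (⟦⟧-∧ (lookup T w) (bag x w)) (*-comm ⟦ lookup T w ⟧ ⟦ bag x w ⟧))
    shared-terminal : ∀ {x y} → x ≢ y → Bag x ∩ Bag y ⊆ T
    shared-terminal {x} {y} x≢y {w} w∈∩ =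
      lookup⇒[]= w T (shared⇒terminal x≢y (∧-conicalˡ _ _ both) (∧-conicalʳ _ _ both))
      where
      both : bag x w ∧ bag y w ≡ true
      both = trans (sym (trans (lookup-∩ (Bag x) (Bag y) w)
                               (cong₂ _∧_ (lookup∘tabulate (bag x) w) (lookup∘tabulate (bag y) w))))
                   ([]=⇒lookup w∈∩)
    ∣Bag∩Bag∣ : ∀ {x y} → x ≢ y → ∣ Bag x ∩ Bag y ∣ ≡ edgesBetween hends x y
    ∣Bag∩Bag∣ {x} {y} x≢y = begin
      ∣ Bag x ∩ Bag y ∣                            ≡⟨ ∣∩Bag∣≡∑ (Bag x) y ⟩
      ∑[ w < n ] ⟦ lookup (Bag x) w ∧ bag y w ⟧    ≡⟨ sum-cong-≗ (λ w → cong (λ b → ⟦ b ∧ bag y w ⟧)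
                                                                       (lookup∘tabulate (bag x) w)) ⟩
      ∑[ w < n ] ⟦ bag x w ∧ bag y w ⟧             ≡⟨ ∑-oriented-joins x≢y ⟨
      ∑[ e < p ] ind (joins? (hends e) x y)        ≡⟨ edgesBetween≡∑ hends x y ⟨
      edgesBetween hends x y                       ∎
      where open ≡-Reasoning

-- Restriction and deletions

pullback : ∀ {n m n′ m′} {ends : Fin m → Fin n × Fin n} {terminal : Fin n → Bool}
             {ends′ : Fin m′ → Fin n′ × Fin n′} {terminal′ : Fin n′ → Bool} →
           (S : BagSystem ends terminal) (g : Fin n′ → Fin n) → Injective _≡_ _≡_ g →
           terminal′ ≗ terminal ∘ g → Spans (λ x → BagSystem.bag S x ∘ g) ends′ → BagSystem ends′ terminal′
pullback {terminal = terminal} {terminal′ = terminal′} S g g-injective terminal′≗ spans′ = record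
  { k               = k
  ; bag             = λ x → bag x ∘ g
  ; colour          = colour
  ; covers          = covers ∘ g
  ; spans           = spans′
  ; shared⇒terminal = λ {_} {_} {w} x≢y x∋w y∋w → trans (terminal′≗ w) (shared⇒terminal x≢y x∋w y∋w)
  ; shared⇒colour≢  = shared⇒colour≢
  ; overlaps≤2      = λ x → ≤-trans (∑-injective-≤ (λ w → ⟦ bag x w ⟧ * (multiplicity bag w ∸ 1)) g-injective)
                                      (overlaps≤2 x)
  ; terminals≤2     = λ x → ≤-trans (≤-reflexive (sum-cong-≗ (terminals-along x)))
                              (≤-trans (∑-injective-≤ (λ w → ⟦ bag x w ⟧ * ⟦ terminal w ⟧) g-injective) (terminals≤2 x))
  }
  where
  open BagSystem S
  terminals-along : ∀ x w → ⟦ bag x (g w) ⟧ * ⟦ terminal′ w ⟧ ≡ ⟦ bag x (g w) ⟧ * ⟦ terminal (g w) ⟧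
  terminals-along x w = cong (λ t → ⟦ bag x (g w) ⟧ * ⟦ t ⟧) (terminal′≗ w)

reindexEdges : ∀ {n m m′} {ends : Fin m → Fin n × Fin n} {terminal : Fin n → Bool} (h : Fin m′ → Fin m) →
               BagSystem ends terminal → BagSystem (ends ∘ h) terminal
reindexEdges h S = pullback S id id (λ _ → refl) (BagSystem.spans S ∘ h)

lookup-removeAt : ∀ {A : Set} {n} (xs : Vec A (suc n)) i j → lookup (removeAt xs i) j ≡ lookup xs (punchIn i j)
lookup-removeAt xs i j = trans (cong (lookup (removeAt xs i)) (sym (punchOut-punchIn i)))
                               (removeAt-punchOut xs (punchInᵢ≢i i j ∘ sym))

deleteIsolatedVertex : ∀ {n m} (ends : Fin m → Fin (suc n) × Fin (suc n)) (T : Subset (suc n)) (v : Fin (suc n))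
  (iso : ∀ e → (v ≢ proj₁ (ends e)) × (v ≢ proj₂ (ends e))) → BagSystem ends (lookup T) →
  BagSystem (λ e → punchOut (proj₁ (iso e)) , punchOut (proj₂ (iso e))) (lookup (removeAt T v))
deleteIsolatedVertex ends T v iso S = pullback S (punchIn v) (punchIn-injective v _ _) (lookup-removeAt T v) spans′
  where
  open BagSystem S
  spans′ : Spans (λ x → bag x ∘ punchIn v) _
  spans′ e with x , x∋a , x∋b ← spans e =
    x , subst (λ a → bag x a ≡ true) (sym (punchIn-punchOut (proj₁ (iso e)))) x∋a
      , subst (λ b → bag x b ≡ true) (sym (punchIn-punchOut (proj₂ (iso e)))) x∋b

-- Merging the bags that meet a terminal edge

m≤m*[m+n] : ∀ m n → m ≤ m * (m + n)
m≤m*[m+n] zero    n = z≤n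
m≤m*[m+n] (suc m) n = m≤m*n (suc m) (suc m + n)

merged-pointwise-arith : ∀ a s → 1 ≤ a → 1 * (1 + s ∸ 1) + 2 * (a ∸ 1) ≤ a * (a + s ∸ 1)
merged-pointwise-arith (suc a) s _ = begin
  1 * s + 2 * a          ≡⟨ rearrange a s ⟩
  (a + s) + a            ≤⟨ +-monoʳ-≤ (a + s) (m≤m*[m+n] a s) ⟩
  (a + s) + a * (a + s)  ∎
  where
  open ≤-Reasoning
  rearrange : ∀ a s → 1 * s + 2 * a ≡ (a + s) + a
  rearrange = solve-∀

merged-overlaps-arith : ∀ D A a b → 1 ≤ a → 1 ≤ b →
                        D + (2 * (a ∸ 1) + 2 * (b ∸ 1)) ≤ A * 2 → A + 1 ≤ a + b → D ≤ 2
merged-overlaps-arith D A (suc p) (suc q) _ _ D+X≤2A A<a+b = +-cancelʳ-≤ (2 * p + 2 * q) D 2 (begin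
  D + (2 * p + 2 * q)    ≤⟨ D+X≤2A ⟩
  A * 2                  ≤⟨ *-monoˡ-≤ 2 (s≤s⁻¹ (subst (_≤ suc p + suc q) (+-comm A 1) A<a+b)) ⟩
  (p + suc q) * 2        ≡⟨ rearrange p q ⟩
  2 + (2 * p + 2 * q)    ∎)
  where
  open ≤-Reasoning
  rearrange : ∀ p q → (p + suc q) * 2 ≡ 2 + (2 * p + 2 * q)
  rearrange = solve-∀

merged-terminals-arith : ∀ Ψ A a b → 1 ≤ a → 1 ≤ b →
                         Ψ + (a + b) ≤ A * 2 → A + 1 ≤ a + b → (a ∸ 1) + (b ∸ 1) ≤ 2 → Ψ ≤ 2
merged-terminals-arith Ψ A (suc p) (suc q) _ _ Ψ+a+b≤2A A<a+b p+q≤2 =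
  ≤-trans (+-cancelʳ-≤ (suc p + suc q) Ψ (p + q) (begin
    Ψ + (suc p + suc q)          ≤⟨ Ψ+a+b≤2A ⟩
    A * 2                        ≤⟨ *-monoˡ-≤ 2 (s≤s⁻¹ (subst (_≤ suc p + suc q) (+-comm A 1) A<a+b)) ⟩
    (p + suc q) * 2              ≡⟨ rearrange p q ⟩
    (p + q) + (suc p + suc q)    ∎)) p+q≤2
  where
  open ≤-Reasoning
  rearrange : ∀ p q → (p + suc q) * 2 ≡ (p + q) + (suc p + suc q)
  rearrange = solve-∀

module Merge {n m : ℕ} {ends : Fin m → Fin n × Fin n} {terminal : Fin n → Bool} (S : BagSystem ends terminal)
             {u v : Fin n} (u≢v : u ≢ v) {x₀ : Fin (BagSystem.k S)}
             (x₀∋u : BagSystem.bag S x₀ u ≡ true) (x₀∋v : BagSystem.bag S x₀ v ≡ true)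
             (u∈T : terminal u ≡ true) (v∈T : terminal v ≡ true) where

  open BagSystem S

  Endpoint : Fin n → Set
  Endpoint w = w ≡ u ⊎ w ≡ v

  endpoint? : ∀ w → Dec (Endpoint w)
  endpoint? w = (w ≟ u) ⊎-dec (w ≟ v)

  terminal⁻ : Fin n → Bool
  terminal⁻ w = terminal w ∧ not (does (endpoint? w))

  meets : Fin k → Bool
  meets y = bag y u ∨ bag y v

  InUnion : Fin n → Set
  InUnion w = ∃ λ y → meets y ∧ bag y w ≡ true

  inUnion? : ∀ w → Dec (InUnion w)
  inUnion? w = any? (λ y → meets y ∧ bag y w B.≟ true)

  -- The bags meeting uv are merged into x₀ and emptied. x₀ switches colour, since every bag sharing a
  -- vertex with a merged bag has the old colour of x₀ (unmet-neighbour).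
  bag′ : Bags k n
  bag′ x w = if does (x ≟ x₀) then does (inUnion? w) else not (meets x) ∧ bag x w

  colour′ : Fin k → Bool
  colour′ x = if does (x ≟ x₀) then not (colour x₀) else colour x

  image : Fin k → Fin k
  image y = if meets y then x₀ else y

  meets-x₀ : meets x₀ ≡ true
  meets-x₀ = cong (_∨ bag x₀ v) x₀∋u

  ∋endpoint⇒meets : ∀ {y w} → Endpoint w → bag y w ≡ true → meets y ≡ true
  ∋endpoint⇒meets {y} (inj₁ refl) y∋u = cong (_∨ bag y v) y∋u
  ∋endpoint⇒meets {y} (inj₂ refl) y∋v = trans (cong (bag y u ∨_) y∋v) (∨-zeroʳ (bag y u))

  unmet⇒≢x₀ : ∀ {y} → meets y ≡ false → y ≢ x₀
  unmet⇒≢x₀ my refl = contradiction (trans (sym my) meets-x₀) λ ()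

  bag′-x₀ : ∀ w → bag′ x₀ w ≡ does (inUnion? w)
  bag′-x₀ w = cong (λ b → if b then does (inUnion? w) else not (meets x₀) ∧ bag x₀ w) (dec-true (x₀ ≟ x₀) refl)

  bag′-other : ∀ {x} w → x ≢ x₀ → bag′ x w ≡ not (meets x) ∧ bag x w
  bag′-other {x} w x≢x₀ = cong (λ b → if b then does (inUnion? w) else not (meets x) ∧ bag x w) (dec-false (x ≟ x₀) x≢x₀)

  colour′-x₀ : colour′ x₀ ≡ not (colour x₀)
  colour′-x₀ = cong (λ b → if b then not (colour x₀) else colour x₀) (dec-true (x₀ ≟ x₀) refl)

  colour′-other : ∀ {x} → x ≢ x₀ → colour′ x ≡ colour x
  colour′-other {x} x≢x₀ = cong (λ b → if b then not (colour x₀) else colour x) (dec-false (x ≟ x₀) x≢x₀)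

  ∋-image : ∀ {y w} → bag y w ≡ true → bag′ (image y) w ≡ true
  ∋-image {y} {w} y∋w with meets y in my
  ... | true  = trans (bag′-x₀ w) (dec-true (inUnion? w) (y , trans (cong (_∧ bag y w) my) y∋w))
  ... | false = trans (bag′-other w (unmet⇒≢x₀ my)) (trans (cong (λ b → not b ∧ bag y w) my) y∋w)

  preimage : ∀ {x w} → bag′ x w ≡ true → ∃ λ z → bag z w ≡ true × image z ≡ x
  preimage {x} {w} x∋w with x ≟ x₀
  preimage {x} {w} x∋w | yes refl with inUnion? w
  ... | yes (z , mz∋w) = z , ∧-conicalʳ _ _ mz∋w , cong (λ b → if b then x₀ else z) (∧-conicalˡ _ _ mz∋w)
  preimage {x} {w} () | yes refl | no _
  preimage {x} {w} x∋w | no x≢x₀ with meets x in mx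
  ... | false = x , x∋w , cong (λ b → if b then x₀ else x) mx
  preimage {x} {w} () | no x≢x₀ | true

  image-injective⁻ : ∀ {z₁ z₂} → image z₁ ≢ image z₂ → z₁ ≢ z₂
  image-injective⁻ images≢ refl = images≢ refl

  private-endpoint : ∀ {x a} → bag′ x a ≡ true → Endpoint a → x ≡ x₀
  private-endpoint x∋a a-endpoint with z , z∋a , refl ← preimage x∋a =
    cong (λ b → if b then x₀ else z) (∋endpoint⇒meets a-endpoint z∋a)

  x₀-terminal : ∀ {w} → bag x₀ w ≡ true → terminal w ≡ true → Endpoint w
  x₀-terminal {w} x₀∋w w∈T with w ≟ u | w ≟ v
  ... | yes w≡u | _       = inj₁ w≡u
  ... | no _    | yes w≡v = inj₂ w≡v
  ... | no w≢u  | no w≢v  = contradiction three (≤⇒≯ (terminals≤2 x₀))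
    where
    t : Fin n → ℕ
    t w = ⟦ bag x₀ w ⟧ * ⟦ terminal w ⟧
    three : 3 ≤ weight bag (⟦_⟧ ∘ terminal) x₀
    three = subst (_≤ sum t) (trans (cong₂ (λ a b → a + (b + t w)) (one x₀∋u u∈T) (one x₀∋v v∈T))
                                    (cong (2 +_) (one x₀∋w w∈T)))
                  (∑-three-≤ t u≢v (w≢u ∘ sym) (w≢v ∘ sym))
      where
      one : ∀ {a b} → a ≡ true → b ≡ true → ⟦ a ⟧ * ⟦ b ⟧ ≡ 1
      one refl refl = refl

  meets⇒colour≢x₀ : ∀ {z} → meets z ≡ true → z ≢ x₀ → colour z ≢ colour x₀
  meets⇒colour≢x₀ {z} mz z≢x₀ with bag z u in z∋u
  ... | true  = shared⇒colour≢ z≢x₀ z∋u x₀∋u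
  ... | false = shared⇒colour≢ z≢x₀ mz x₀∋v

  unmet-neighbour : ∀ {z y w} → meets z ≡ true → meets y ≡ false → bag z w ≡ true → bag y w ≡ true → colour y ≡ colour x₀
  unmet-neighbour {z} {y} {w} mz my z∋w y∋w with z ≟ x₀
  ... | yes refl = contradiction (trans (sym my) (∋endpoint⇒meets w-endpoint y∋w)) λ ()
    where
    w-endpoint : Endpoint w
    w-endpoint = x₀-terminal z∋w (shared⇒terminal (unmet⇒≢x₀ my ∘ sym) z∋w y∋w)
  ... | no z≢x₀ = begin
    colour y               ≡⟨ ¬-not (shared⇒colour≢ y≢z y∋w z∋w) ⟩
    not (colour z)         ≡⟨ cong not (¬-not (meets⇒colour≢x₀ mz z≢x₀)) ⟩
    not (not (colour x₀))  ≡⟨ not-involutive (colour x₀) ⟩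
    colour x₀              ∎
    where
    open ≡-Reasoning
    y≢z : y ≢ z
    y≢z refl = contradiction (trans (sym my) mz) λ ()

  colour′-image : ∀ z → colour′ (image z) ≡ (if meets z then not (colour x₀) else colour z)
  colour′-image z with meets z in mz
  ... | true  = colour′-x₀
  ... | false = colour′-other (unmet⇒≢x₀ mz)

  shared⇒colour′≢ : ∀ {x y w} → x ≢ y → bag′ x w ≡ true → bag′ y w ≡ true → colour′ x ≢ colour′ y
  shared⇒colour′≢ x≢y x∋w y∋w with z₁ , z₁∋w , refl ← preimage x∋w | z₂ , z₂∋w , refl ← preimage y∋w
    rewrite colour′-image z₁ | colour′-image z₂ with meets z₁ in m₁ | meets z₂ in m₂
  ... | true  | true  = contradiction refl x≢y
  ... | false | false = shared⇒colour≢ x≢y z₁∋w z₂∋w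
  ... | true  | false = λ eq → not-¬ refl (sym (trans eq (unmet-neighbour m₁ m₂ z₁∋w z₂∋w)))
  ... | false | true  = λ eq → not-¬ refl (trans (sym (unmet-neighbour m₂ m₁ z₂∋w z₁∋w)) eq)

  terminal⁻-other : ∀ {w} → ¬ Endpoint w → terminal⁻ w ≡ terminal w
  terminal⁻-other {w} ¬endpoint = trans (cong (λ b → terminal w ∧ not b) (dec-false (endpoint? w) ¬endpoint))
                                        (∧-identityʳ (terminal w))

  terminal⁻-endpoint : ∀ {w} → Endpoint w → terminal⁻ w ≡ false
  terminal⁻-endpoint {w} endpoint = trans (cong (λ b → terminal w ∧ not b) (dec-true (endpoint? w) endpoint))
                                          (∧-zeroʳ (terminal w))

  shared⇒terminal⁻ : ∀ {x y w} → x ≢ y → bag′ x w ≡ true → bag′ y w ≡ true → terminal⁻ w ≡ true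
  shared⇒terminal⁻ {x} {y} {w} x≢y x∋w y∋w with z₁ , z₁∋w , refl ← preimage x∋w | z₂ , z₂∋w , refl ← preimage y∋w =
    trans (terminal⁻-other not-endpoint) (shared⇒terminal (image-injective⁻ x≢y) z₁∋w z₂∋w)
    where
    not-endpoint : ¬ Endpoint w
    not-endpoint endpoint = x≢y (trans (private-endpoint x∋w endpoint) (sym (private-endpoint y∋w endpoint)))

  inMerged : Fin n → Bool
  inMerged w = does (inUnion? w)

  mergedMultiplicity unmergedMultiplicity excess : Fin n → ℕ
  mergedMultiplicity w   = ∑[ y < k ] ⟦ meets y ∧ bag y w ⟧
  unmergedMultiplicity w = ∑[ y < k ] ⟦ not (meets y) ∧ bag y w ⟧
  excess w               = mergedMultiplicity w ∸ ⟦ inMerged w ⟧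

  mergedCount : ℕ
  mergedCount = ∑[ y < k ] ⟦ meets y ⟧

  multiplicity-split : ∀ w → multiplicity bag w ≡ mergedMultiplicity w + unmergedMultiplicity w
  multiplicity-split w = trans (sum-cong-≗ λ y → split (meets y) (bag y w))
                               (∑-distrib-+ (λ y → ⟦ meets y ∧ bag y w ⟧) (λ y → ⟦ not (meets y) ∧ bag y w ⟧))
    where
    split : ∀ a b → ⟦ b ⟧ ≡ ⟦ a ∧ b ⟧ + ⟦ not a ∧ b ⟧
    split true  b = sym (+-identityʳ ⟦ b ⟧)
    split false b = refl

  multiplicity′ : ∀ w → multiplicity bag′ w ≡ ⟦ inMerged w ⟧ + unmergedMultiplicity w
  multiplicity′ w = begin
    ∑[ x < k ] ⟦ bag′ x w ⟧
      ≡⟨ sum-cong-≗ pointwise ⟩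
    ∑[ x < k ] (ind (x ≟ x₀) * ⟦ inMerged w ⟧ + ⟦ not (meets x) ∧ bag x w ⟧)
      ≡⟨ ∑-distrib-+ (λ x → ind (x ≟ x₀) * ⟦ inMerged w ⟧) (λ x → ⟦ not (meets x) ∧ bag x w ⟧) ⟩
    ∑[ x < k ] (ind (x ≟ x₀) * ⟦ inMerged w ⟧) + unmergedMultiplicity w
      ≡⟨ cong (_+ unmergedMultiplicity w) (∑-δ x₀ (λ _ → ⟦ inMerged w ⟧)) ⟩
    ⟦ inMerged w ⟧ + unmergedMultiplicity w ∎
    where
    open ≡-Reasoning
    pointwise : ∀ x → ⟦ bag′ x w ⟧ ≡ ind (x ≟ x₀) * ⟦ inMerged w ⟧ + ⟦ not (meets x) ∧ bag x w ⟧
    pointwise x with x ≟ x₀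
    ... | yes refl = sym (trans (cong₂ _+_ (*-identityˡ ⟦ inMerged w ⟧) (cong (λ b → ⟦ not b ∧ bag x₀ w ⟧) meets-x₀))
                                (+-identityʳ ⟦ inMerged w ⟧))
    ... | no _     = refl

  inMerged≤ : ∀ w → ⟦ inMerged w ⟧ ≤ mergedMultiplicity w
  inMerged≤ w with inUnion? w
  ... | yes (y , my∋w) = subst (_≤ mergedMultiplicity w) (cong ⟦_⟧ my∋w) (≤-∑ (λ y → ⟦ meets y ∧ bag y w ⟧) y)
  ... | no _           = z≤n

  outsideMerged : ∀ {w} → ¬ InUnion w → mergedMultiplicity w ≡ 0
  outsideMerged ¬in = ∑-zero λ y → ⟦⟧-≢true λ my∋w → ¬in (y , my∋w)

  endpoint-inMerged : ∀ {w} → Endpoint w → inMerged w ≡ true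
  endpoint-inMerged {w} endpoint = dec-true (inUnion? w) (x₀ , trans (cong (_∧ bag x₀ w) meets-x₀) (x₀∋endpoint endpoint))
    where
    x₀∋endpoint : Endpoint w → bag x₀ w ≡ true
    x₀∋endpoint (inj₁ refl) = x₀∋u
    x₀∋endpoint (inj₂ refl) = x₀∋v

  endpoint-mergedMultiplicity : ∀ {w} → Endpoint w → mergedMultiplicity w ≡ multiplicity bag w
  endpoint-mergedMultiplicity endpoint = sum-cong-≗ λ y → ⟦⟧-∧-implied (∋endpoint⇒meets {y} endpoint)

  endpoint-excess : ∀ {w} → Endpoint w → excess w ≡ multiplicity bag w ∸ 1
  endpoint-excess endpoint = cong₂ (λ a b → a ∸ ⟦ b ⟧) (endpoint-mergedMultiplicity endpoint) (endpoint-inMerged endpoint)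

  ∑-mergedMultiplicity-weighted : ∀ h → (∀ y → weight bag h y ≤ 2) → ∑[ w < n ] (mergedMultiplicity w * h w) ≤ mergedCount * 2
  ∑-mergedMultiplicity-weighted h weight≤2 = begin
    ∑[ w < n ] (mergedMultiplicity w * h w)
      ≡⟨ sum-cong-≗ (λ w → *-distribʳ-sum (h w) (λ y → ⟦ meets y ∧ bag y w ⟧)) ⟩
    ∑[ w < n ] ∑[ y < k ] (⟦ meets y ∧ bag y w ⟧ * h w)
      ≡⟨ ∑-comm (λ w y → ⟦ meets y ∧ bag y w ⟧ * h w) ⟩
    ∑[ y < k ] ∑[ w < n ] (⟦ meets y ∧ bag y w ⟧ * h w)
      ≡⟨ sum-cong-≗ (λ y → trans (sum-cong-≗ (factor y)) (sym (*-distribˡ-sum ⟦ meets y ⟧ (λ w → ⟦ bag y w ⟧ * h w)))) ⟩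
    ∑[ y < k ] (⟦ meets y ⟧ * weight bag h y)
      ≤⟨ ∑-mono-≤ (λ y → *-monoʳ-≤ ⟦ meets y ⟧ (weight≤2 y)) ⟩
    ∑[ y < k ] (⟦ meets y ⟧ * 2)
      ≡⟨ *-distribʳ-sum 2 (λ y → ⟦ meets y ⟧) ⟨
    mergedCount * 2 ∎
    where
    open ≤-Reasoning
    factor : ∀ y w → ⟦ meets y ∧ bag y w ⟧ * h w ≡ ⟦ meets y ⟧ * (⟦ bag y w ⟧ * h w)
    factor y w = trans (cong (_* h w) (⟦⟧-∧ (meets y) (bag y w))) (*-assoc ⟦ meets y ⟧ ⟦ bag y w ⟧ (h w))

  mergedCount<multiplicities : mergedCount + 1 ≤ multiplicity bag u + multiplicity bag v
  mergedCount<multiplicities = begin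
    mergedCount + 1
      ≤⟨ +-monoʳ-≤ mergedCount (subst (_≤ sum both) (cong₂ (λ a b → ⟦ a ∧ b ⟧) x₀∋u x₀∋v) (≤-∑ both x₀)) ⟩
    mergedCount + sum both
      ≡⟨ ∑-distrib-+ (λ y → ⟦ meets y ⟧) both ⟨
    ∑[ y < k ] (⟦ meets y ⟧ + both y)
      ≡⟨ sum-cong-≗ (λ y → ⟦⟧-∨+∧ (bag y u) (bag y v)) ⟩
    ∑[ y < k ] (⟦ bag y u ⟧ + ⟦ bag y v ⟧)
      ≡⟨ ∑-distrib-+ (λ y → ⟦ bag y u ⟧) (λ y → ⟦ bag y v ⟧) ⟩
    multiplicity bag u + multiplicity bag v ∎
    where
    open ≤-Reasoning
    both : Fin k → ℕ
    both y = ⟦ bag y u ∧ bag y v ⟧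

  bag′⊆bag : ∀ {x w} → x ≢ x₀ → bag′ x w ≡ true → bag x w ≡ true
  bag′⊆bag {x} {w} x≢x₀ x∋w = ∧-conicalʳ (not (meets x)) (bag x w) (trans (sym (bag′-other w x≢x₀)) x∋w)

  multiplicity′≤ : ∀ w → multiplicity bag′ w ≤ multiplicity bag w
  multiplicity′≤ w = subst₂ _≤_ (sym (multiplicity′ w)) (sym (multiplicity-split w))
                                (+-monoˡ-≤ (unmergedMultiplicity w) (inMerged≤ w))

  x₀∋⇒positive : ∀ {w} → bag x₀ w ≡ true → 1 ≤ multiplicity bag w
  x₀∋⇒positive {w} x₀∋w = subst (_≤ multiplicity bag w) (cong ⟦_⟧ x₀∋w) (≤-∑ (λ y → ⟦ bag y w ⟧) x₀)

  endpoints≤overlaps : (multiplicity bag u ∸ 1) + (multiplicity bag v ∸ 1) ≤ overlaps bag x₀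
  endpoints≤overlaps = subst (_≤ overlaps bag x₀) (cong₂ _+_ (one x₀∋u) (one x₀∋v))
                             (∑-two-≤ (λ w → ⟦ bag x₀ w ⟧ * (multiplicity bag w ∸ 1)) u≢v)
    where
    one : ∀ {w} → bag x₀ w ≡ true → ⟦ bag x₀ w ⟧ * (multiplicity bag w ∸ 1) ≡ multiplicity bag w ∸ 1
    one {w} x₀∋w = trans (cong (λ b → ⟦ b ⟧ * (multiplicity bag w ∸ 1)) x₀∋w) (*-identityˡ _)

  -- Double counting: the merged bags have overlaps ≤ 2 each, and merging removes the excess at u and v.
  overlaps′-x₀ : overlaps bag′ x₀ ≤ 2
  overlaps′-x₀ = merged-overlaps-arith (overlaps bag′ x₀) mergedCount (multiplicity bag u) (multiplicity bag v)
                   (x₀∋⇒positive x₀∋u) (x₀∋⇒positive x₀∋v) bound mergedCount<multiplicities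
    where
    N = multiplicity bag
    pointwise : ∀ w → ⟦ bag′ x₀ w ⟧ * (multiplicity bag′ w ∸ 1) + 2 * excess w ≤ mergedMultiplicity w * (N w ∸ 1)
    pointwise w rewrite bag′-x₀ w | multiplicity′ w | multiplicity-split w with inUnion? w | inMerged≤ w
    ... | yes _  | positive = merged-pointwise-arith (mergedMultiplicity w) (unmergedMultiplicity w) positive
    ... | no ¬in | _        rewrite outsideMerged ¬in = z≤n
    bound : overlaps bag′ x₀ + (2 * (N u ∸ 1) + 2 * (N v ∸ 1)) ≤ mergedCount * 2
    bound = begin
      overlaps bag′ x₀ + (2 * (N u ∸ 1) + 2 * (N v ∸ 1))
        ≡⟨ cong₂ (λ a b → overlaps bag′ x₀ + (2 * a + 2 * b)) (endpoint-excess (inj₁ refl)) (endpoint-excess (inj₂ refl)) ⟨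
      overlaps bag′ x₀ + (2 * excess u + 2 * excess v)
        ≤⟨ +-monoʳ-≤ (overlaps bag′ x₀) (∑-two-≤ (λ w → 2 * excess w) u≢v) ⟩
      overlaps bag′ x₀ + ∑[ w < n ] (2 * excess w)
        ≡⟨ ∑-distrib-+ (λ w → ⟦ bag′ x₀ w ⟧ * (multiplicity bag′ w ∸ 1)) (λ w → 2 * excess w) ⟨
      ∑[ w < n ] (⟦ bag′ x₀ w ⟧ * (multiplicity bag′ w ∸ 1) + 2 * excess w)
        ≤⟨ ∑-mono-≤ pointwise ⟩
      ∑[ w < n ] (mergedMultiplicity w * (N w ∸ 1))
        ≤⟨ ∑-mergedMultiplicity-weighted (λ w → N w ∸ 1) overlaps≤2 ⟩
      mergedCount * 2 ∎
      where open ≤-Reasoning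

  terminals′-x₀ : weight bag′ (⟦_⟧ ∘ terminal⁻) x₀ ≤ 2
  terminals′-x₀ = merged-terminals-arith (weight bag′ (⟦_⟧ ∘ terminal⁻) x₀) mergedCount (N u) (N v)
                    (x₀∋⇒positive x₀∋u) (x₀∋⇒positive x₀∋v) bound mergedCount<multiplicities
                    (≤-trans endpoints≤overlaps (overlaps≤2 x₀))
    where
    N = multiplicity bag
    f g r : Fin n → ℕ
    f w = ⟦ bag′ x₀ w ⟧ * ⟦ terminal⁻ w ⟧
    g w = mergedMultiplicity w * ⟦ terminal w ⟧
    r w = g w ∸ f w
    f≤g : ∀ w → f w ≤ g w
    f≤g w rewrite bag′-x₀ w = *-mono-≤ (inMerged≤ w) (⟦⟧-mono (∧-conicalˡ (terminal w) _))
    endpoint-r : ∀ {w} → Endpoint w → r w ≡ N w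
    endpoint-r {w} endpoint = begin
      g w ∸ f w                  ≡⟨ cong (λ t → g w ∸ ⟦ bag′ x₀ w ⟧ * ⟦ t ⟧) (terminal⁻-endpoint endpoint) ⟩
      g w ∸ ⟦ bag′ x₀ w ⟧ * 0    ≡⟨ cong (g w ∸_) (*-zeroʳ ⟦ bag′ x₀ w ⟧) ⟩
      g w                        ≡⟨ cong (λ t → mergedMultiplicity w * ⟦ t ⟧) (terminal-endpoint endpoint) ⟩
      mergedMultiplicity w * 1   ≡⟨ *-identityʳ _ ⟩
      mergedMultiplicity w       ≡⟨ endpoint-mergedMultiplicity endpoint ⟩
      N w                        ∎
      where
      open ≡-Reasoning
      terminal-endpoint : ∀ {w} → Endpoint w → terminal w ≡ true
      terminal-endpoint (inj₁ refl) = u∈T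
      terminal-endpoint (inj₂ refl) = v∈T
    bound : weight bag′ (⟦_⟧ ∘ terminal⁻) x₀ + (N u + N v) ≤ mergedCount * 2
    bound = begin
      sum f + (N u + N v)      ≡⟨ cong (sum f +_) (cong₂ _+_ (endpoint-r (inj₁ refl)) (endpoint-r (inj₂ refl))) ⟨
      sum f + (r u + r v)      ≤⟨ +-monoʳ-≤ (sum f) (∑-two-≤ r u≢v) ⟩
      sum f + sum r            ≡⟨ ∑-distrib-+ f r ⟨
      ∑[ w < n ] (f w + r w)   ≡⟨ sum-cong-≗ (λ w → m+[n∸m]≡n (f≤g w)) ⟩
      sum g                    ≤⟨ ∑-mergedMultiplicity-weighted (⟦_⟧ ∘ terminal) terminals≤2 ⟩
      mergedCount * 2          ∎
      where open ≤-Reasoning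

  overlaps′≤2 : ∀ x → overlaps bag′ x ≤ 2
  overlaps′≤2 x = by-cases (x ≟ x₀)
    where
    by-cases : Dec (x ≡ x₀) → overlaps bag′ x ≤ 2
    by-cases (yes refl) = overlaps′-x₀
    by-cases (no x≢x₀)  = ≤-trans (∑-mono-≤ λ w → *-mono-≤ (⟦⟧-mono (bag′⊆bag x≢x₀)) (∸-monoˡ-≤ 1 (multiplicity′≤ w)))
                                    (overlaps≤2 x)

  terminals′≤2 : ∀ x → weight bag′ (⟦_⟧ ∘ terminal⁻) x ≤ 2
  terminals′≤2 x = by-cases (x ≟ x₀)
    where
    by-cases : Dec (x ≡ x₀) → weight bag′ (⟦_⟧ ∘ terminal⁻) x ≤ 2
    by-cases (yes refl) = terminals′-x₀
    by-cases (no x≢x₀)  = ≤-trans (∑-mono-≤ λ w → *-mono-≤ (⟦⟧-mono (bag′⊆bag x≢x₀)) (⟦⟧-mono (∧-conicalˡ (terminal w) _)))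
                                    (terminals≤2 x)

  merged : BagSystem ends terminal⁻
  merged = record
    { k               = k
    ; bag             = bag′
    ; colour          = colour′
    ; covers          = map image ∋-image ∘ covers
    ; spans           = map image (map ∋-image ∋-image) ∘ spans
    ; shared⇒terminal = shared⇒terminal⁻
    ; shared⇒colour≢  = shared⇒colour′≢
    ; overlaps≤2      = overlaps′≤2
    ; terminals≤2     = terminals′≤2
    }

  x₀∋′u : bag′ x₀ u ≡ true
  x₀∋′u = trans (bag′-x₀ u) (endpoint-inMerged (inj₁ refl))

-- Contraction

module Contraction {n m : ℕ} (ends : Fin (suc m) → Fin (suc n) × Fin (suc n)) (T : Subset (suc n))
                   (e : Fin (suc m)) (u≢v : proj₁ (ends e) ≢ proj₂ (ends e)) where

  u v : Fin (suc n)
  u = proj₁ (ends e)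
  v = proj₂ (ends e)

  contract : Fin (suc n) → Fin n
  contract = merge u v u≢v

  e* : Fin n
  e* = contract u

  ends′ : Fin m → Fin n × Fin n
  ends′ f = mapPair contract (ends (punchIn e f))

  T′ : Subset n
  T′ = contractT u v u≢v T

  punchIn-contract : ∀ {a} → a ≢ v → punchIn v (contract a) ≡ a
  punchIn-contract {a} a≢v with a ≟ v
  ... | yes a≡v = contradiction a≡v a≢v
  ... | no _    = punchIn-punchOut _

  contract-punchIn : ∀ w → contract (punchIn v w) ≡ w
  contract-punchIn w with punchIn v w ≟ v
  ... | yes w≡v = contradiction w≡v (punchInᵢ≢i v w)
  ... | no _    = trans (punchOut-cong v refl) (punchOut-punchIn v)

  contract-v : contract v ≡ e*
  contract-v with v ≟ v | u ≟ v
  ... | yes _ | yes u≡v = contradiction u≡v u≢v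
  ... | yes _ | no _    = punchOut-cong v refl
  ... | no v≢v | _      = contradiction refl v≢v

  contract≡e*⇒endpoint : ∀ {a} → contract a ≡ e* → a ≡ u ⊎ a ≡ v
  contract≡e*⇒endpoint {a} a↦e* = by-cases (a ≟ v)
    where
    open ≡-Reasoning
    by-cases : Dec (a ≡ v) → a ≡ u ⊎ a ≡ v
    by-cases (yes a≡v) = inj₂ a≡v
    by-cases (no a≢v)  = inj₁ (begin
      a                      ≡⟨ punchIn-contract a≢v ⟨
      punchIn v (contract a) ≡⟨ cong (punchIn v) a↦e* ⟩
      punchIn v e*           ≡⟨ punchIn-contract u≢v ⟩
      u                      ∎)

  -- the case split of contractT is local to Defs, hence the function left to unification below
  T′-e* : lookup T′ e* ≡ lookup T u xor lookup T v
  T′-e* rewrite (lookup T′ e* ≡ _) ∋ lookup∘tabulate _ e* with e* ≟ e*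
  ... | yes _    = refl
  ... | no e*≢e* = contradiction refl e*≢e*

  T′-other : ∀ {w} → w ≢ e* → lookup T′ w ≡ lookup T (punchIn v w)
  T′-other {w} w≢e* rewrite (lookup T′ w ≡ _) ∋ lookup∘tabulate _ w with w ≟ e*
  ... | yes w≡e* = contradiction w≡e* w≢e*
  ... | no _     = refl

  reinsert : Fin (suc n) → Fin n → Fin (suc n)
  reinsert z w = if does (w ≟ e*) then z else punchIn v w

  reinsert-e* : ∀ z → reinsert z e* ≡ z
  reinsert-e* z = cong (λ b → if b then z else punchIn v e*) (dec-true (e* ≟ e*) refl)

  reinsert-other : ∀ z {w} → w ≢ e* → reinsert z w ≡ punchIn v w
  reinsert-other z {w} w≢e* = cong (λ b → if b then z else punchIn v w) (dec-false (w ≟ e*) w≢e*)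

  reinsert-injective : ∀ {z} → contract z ≡ e* → Injective _≡_ _≡_ (reinsert z)
  reinsert-injective {z} z↦e* {w₁} {w₂} = by-cases (w₁ ≟ e*) (w₂ ≟ e*)
    where
    hits-e* : ∀ {w} → z ≡ punchIn v w → w ≡ e*
    hits-e* {w} z≡ = trans (sym (contract-punchIn w)) (trans (cong contract (sym z≡)) z↦e*)
    by-cases : ∀ {w₁ w₂} → Dec (w₁ ≡ e*) → Dec (w₂ ≡ e*) → reinsert z w₁ ≡ reinsert z w₂ → w₁ ≡ w₂
    by-cases (yes w₁≡e*) (yes w₂≡e*) _  = trans w₁≡e* (sym w₂≡e*)
    by-cases {w₁} {w₂} (yes w₁≡e*) (no w₂≢e*)  eq = contradiction (hits-e* (begin
      z              ≡⟨ reinsert-e* z ⟨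
      reinsert z e*  ≡⟨ cong (reinsert z) w₁≡e* ⟨
      reinsert z w₁  ≡⟨ eq ⟩
      reinsert z w₂  ≡⟨ reinsert-other z w₂≢e* ⟩
      punchIn v w₂   ∎)) w₂≢e*
      where open ≡-Reasoning
    by-cases (no w₁≢e*)  (yes w₂≡e*) eq = sym (by-cases (yes w₂≡e*) (no w₁≢e*) (sym eq))
    by-cases {w₁} {w₂} (no w₁≢e*)  (no w₂≢e*)  eq =
      punchIn-injective v w₁ w₂ (trans (sym (reinsert-other z w₁≢e*)) (trans eq (reinsert-other z w₂≢e*)))

  contractOnto : ∀ {terminal} (S : BagSystem ends terminal) (z : Fin (suc n)) → contract z ≡ e* →
                 (∀ {x a} → contract a ≡ e* → BagSystem.bag S x a ≡ true → BagSystem.bag S x z ≡ true) →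
                 lookup T′ ≗ terminal ∘ reinsert z → BagSystem ends′ (lookup T′)
  contractOnto S z z↦e* e*-bags∋z T′≗ = pullback S (reinsert z) (reinsert-injective z↦e*) T′≗ spans′
    where
    open BagSystem S
    ∋-reinsert : ∀ {x a} → bag x a ≡ true → bag x (reinsert z (contract a)) ≡ true
    ∋-reinsert {x} {a} x∋a = by-cases (contract a ≟ e*)
      where
      by-cases : Dec (contract a ≡ e*) → bag x (reinsert z (contract a)) ≡ true
      by-cases (yes a↦e*) = subst (λ b → bag x b ≡ true)
                              (sym (trans (cong (reinsert z) a↦e*) (reinsert-e* z))) (e*-bags∋z a↦e* x∋a)
      by-cases (no a↦̸e*)  = subst (λ b → bag x b ≡ true)
                              (sym (trans (reinsert-other z a↦̸e*) (punchIn-contract (λ { refl → a↦̸e* contract-v })))) x∋a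
    spans′ : Spans (λ x → bag x ∘ reinsert z) ends′
    spans′ f = map₂ (map ∋-reinsert ∋-reinsert) (spans (punchIn e f))

  T′≗ : ∀ {terminal : Fin (suc n) → Bool} z → lookup T u xor lookup T v ≡ terminal z →
        (∀ {w} → w ≢ e* → lookup T (punchIn v w) ≡ terminal (punchIn v w)) → lookup T′ ≗ terminal ∘ reinsert z
  T′≗ {terminal} z at-e* elsewhere w = by-cases (w ≟ e*)
    where
    by-cases : Dec (w ≡ e*) → lookup T′ w ≡ terminal (reinsert z w)
    by-cases (yes refl)  = trans T′-e* (trans at-e* (cong terminal (sym (reinsert-e* z))))
    by-cases (no w≢e*)   = trans (T′-other w≢e*) (trans (elsewhere w≢e*) (cong terminal (sym (reinsert-other z w≢e*))))

  contractStep : BagSystem ends (lookup T) → BagSystem ends′ (lookup T′)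
  contractStep S with x₀ , x₀∋u , x₀∋v ← BagSystem.spans S e | lookup T u in Tu | lookup T v in Tv
  ... | _     | false = contractOnto S u refl e*-bags∋u (T′≗ {lookup T} u (xor-false (lookup T u) Tv) (λ _ → refl))
    where
    open BagSystem S
    e*-bags∋u : ∀ {x a} → contract a ≡ e* → bag x a ≡ true → bag x u ≡ true
    e*-bags∋u {x} {a} a↦e* x∋a with contract≡e*⇒endpoint {a} a↦e*
    ... | inj₁ refl = x∋a
    ... | inj₂ refl = subst (λ y → bag y u ≡ true) (sym (nonterminal⇒private S Tv x₀∋v x∋a)) x₀∋u
  ... | false | true  = contractOnto S v contract-v e*-bags∋v (T′≗ {lookup T} v (trans (cong₂ _xor_ Tu Tv) (sym Tv)) (λ _ → refl))
    where
    open BagSystem S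
    e*-bags∋v : ∀ {x a} → contract a ≡ e* → bag x a ≡ true → bag x v ≡ true
    e*-bags∋v {x} {a} a↦e* x∋a with contract≡e*⇒endpoint {a} a↦e*
    ... | inj₁ refl = subst (λ y → bag y v ≡ true) (sym (nonterminal⇒private S Tu x₀∋u x∋a)) x₀∋v
    ... | inj₂ refl = x∋a
  ... | true  | true  = contractOnto merged u refl e*-bags∋u
                          (T′≗ {terminal⁻} u (trans (cong₂ _xor_ Tu Tv) (sym (terminal⁻-endpoint (inj₁ refl)))) elsewhere)
    where
    open Merge S u≢v x₀∋u x₀∋v Tu Tv
    e*-bags∋u : ∀ {x a} → contract a ≡ e* → bag′ x a ≡ true → bag′ x u ≡ true
    e*-bags∋u {a = a} a↦e* x∋a =
      subst (λ y → bag′ y u ≡ true) (sym (private-endpoint x∋a (contract≡e*⇒endpoint {a} a↦e*))) x₀∋′u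
    elsewhere : ∀ {w} → w ≢ e* → lookup T (punchIn v w) ≡ terminal⁻ (punchIn v w)
    elsewhere {w} w≢e* = sym (terminal⁻-other λ
      { (inj₁ w↦u) → w≢e* (trans (sym (contract-punchIn w)) (cong contract w↦u))
      ; (inj₂ w↦v) → punchInᵢ≢i v w w↦v })

step : ∀ {G H} → Step G H → BagSystemOf G → BagSystemOf H
step (deleteEdge ends T e)              = reindexEdges (punchIn e)
step (deleteIsolated ends T v isolated) = deleteIsolatedVertex ends T v isolated
step (contractLoop ends T e _)          = reindexEdges (punchIn e)
step (contractEdge ends T e u≢v)        = Contraction.contractStep ends T e u≢v

lemma3p8 : (G H : Graft) → CyclicDecomposition G → H ≼ G → CyclicDecomposition H
lemma3p8 G H D H≼G = cyclicDecomposition (minors (bagSystem G D))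
  where
  minors : BagSystemOf G → BagSystemOf H
  minors = fold (λ G H → BagSystemOf G → BagSystemOf H) (λ s next → next ∘ step s) id H≼G
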